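{- Let $\mathcal{L}$ be a library, $\Gamma'$ a method specification and $\sigma\in\Sigma$. If $\lambda\in[\![\mathcal{L}:\Gamma']\!]\sigma$, then $\mathsf{history}(\lambda)$ is balanced from $\delta(\sigma)$.
   Context: Separation algebra: a set $\Sigma$ with a partial commutative, associative (both sides defined and equal or both undefined), cancellative binary operation $*$ with unit $e$; $(\sigma_1*\sigma_2)\downarrow$ means defined; $\sigma_2\setminus\sigma_1$ is the unique $\sigma$ with $\sigma_2=\sigma*\sigma_1$. Footprint $\delta(\sigma)=\{\sigma'\mid\forall\sigma''.(\sigma'*\sigma'')\downarrow\iff(\sigma*\sigma'')\downarrow\}$; $\delta(\sigma_1)\circ\delta(\sigma_2)=\delta(\sigma_1*\sigma_2)$ if defined. Standing assumption: $*$ is cancellative on footprints (if $\sigma_1*\sigma_2,\sigma_1'*\sigma_2'$ defined, $\delta(\sigma_1*\sigma_2)=\delta(\sigma_1'*\sigma_2')$ and $\delta(\sigma_1)=\delta(\sigma_1')$ imply $\delta(\sigma_2)=\delta(\sigma_2')$). $l_2\mathbin{\backslash\!\backslash}l_1=\delta(\sigma)$ if $l_1=\delta(\sigma_1),l_2=\delta(\sigma_2),\sigma_2=\sigma_1*\sigma$, undefined otherwise. Histories: sequences of interface actions $(t,\mathsf{call}\,m(\sigma))$, $(t,\mathsf{ret}\,m(\sigma))$ (per thread alternating, matching methods, starting with a call). $[\![\varepsilon]\!]^\sharp l=l$; $[\![H\psi]\!]^\sharp l=([\![H]\!]^\sharp l)\circ\delta(\sigma)$ for a call carrying $\sigma$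 and $([\![H]\!]^\sharp l)\mathbin{\backslash\!\backslash}\delta(\sigma)$ for a return carrying $\sigma$ (undefined if anything undefined). $H$ is balanced from $l$ if $[\![H]\!]^\sharp l$ is defined. Primitive commands $c$ have transformers $f^t_c:\Sigma\to\mathcal{P}(\Sigma)\cup\{\top\}$ satisfying Footprint Preservation ($\sigma'\in f^t_c(\sigma)\Rightarrow\delta(\sigma')=\delta(\sigma)$) and Strong Locality ($(\sigma_1*\sigma_2)\downarrow$, $f^t_c(\sigma_1)\ne\top$ imply $f^t_c(\sigma_1*\sigma_2)=\{\sigma'*\sigma_2\mid\sigma'\in f^t_c(\sigma_1)\}$). A library is $\mathcal{L}=\{m=C_m\mid m\in M\}$ with bodies $C::=c\mid C;C\mid C+C\mid C^*$. A predicate $r\subseteq\Sigma$ is precise if each $\sigma$ has at most one $\sigma_1\in r$ with $\sigma=\sigma_1*\sigma_2$; then $\sigma\setminus r=\sigma_2$. A method specification is a set of triples $\{p\}m\{q\}$ (at most one per method) with $p,q$ maps from threads $t$ to precise predicates $p_t,q_t$. Library-local semantics $[\![\mathcal{L}:\Gamma']\!]\sigma$: the trace set is the prefix closure of the union over $k\ge1$ of all interleavings of $k$ threads, each thread $t$ finitely often choosing a method $m$ and producing $(t,\mathsf{call}\,m)\,\tau\,(t,\mathsf{ret}\,m)$ with $\tau$ a sequence of actions $(t,c)$ generated by $C_m$. Evaluation of an action from a state (set of (state, annotated action) pairs or $\top$): $(t,c)$ gives $\top$ if $f^t_c(\sigma)=\top$ else $\{(\sigma',(t,c))\mid\sigma'\in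 f^t_c(\sigma)\}$; for $\{p\}m\{q\}\in\Gamma'$, $(t,\mathsf{call}\,m)$ gives $\{(\sigma*\sigma_p,(t,\mathsf{call}\,m(\sigma_p)))\mid\sigma_p\in p_t,(\sigma*\sigma_p)\downarrow\}$, and $(t,\mathsf{ret}\,m)$ gives $\top$ if $\sigma\setminus q_t$ undefined, else $\{(\sigma\setminus q_t,(t,\mathsf{ret}\,m(\sigma_q)))\}$ with $\sigma_q\in q_t$ the unique substate; calls/returns of methods not specified in $\Gamma'$ give $\{(\sigma,\varphi)\}$ unannotated. Traces are evaluated step by step ($\top$ if any step from a reachable state faults). $[\![\mathcal{L}:\Gamma']\!]\sigma=\top$ if some trace evaluates to $\top$ from $\sigma$, else the set of resulting annotated traces. $\mathsf{history}(\lambda)$ is the subsequence of interface (call/return) actions of $\lambda$. -}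

module Defs where

open import Level using (0ℓ)
open import Data.Nat using (ℕ; _≥_)
open import Data.Fin using (Fin; toℕ)
open import Data.Vec using (Vec; lookup; _[_]≔_)
open import Data.Vec.Relation.Unary.All as VAll using ()
open import Data.List using (List; []; _∷_; _++_; [_]; map)
open import Data.Maybe using (Maybe; just; nothing; _>>=_)
open import Data.Product using (Σ; ∃; ∃-syntax; _×_; _,_)
open import Relation.Nullary using (¬_)
open import Relation.Binary.PropositionalEquality using (_≡_)

Defined : {S : Set} → Maybe S → Set
Defined {S} m = ∃[ x ] (m ≡ just x)

record SepAlg : Set₁ where
  field
    S      : Set
    _*_    : S → S → Maybe S
    e      : S
    comm   : ∀ a b → a * b ≡ b * a
    assoc  : ∀ a b c → ((a * b) >>= λ ab → ab * c) ≡ ((b * c) >>= λ bc → a * bc)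
    unit   : ∀ a → e * a ≡ just a
    cancel : ∀ {a₁ a₂ b c} → a₁ * b ≡ just c → a₂ * b ≡ just c → a₁ ≡ a₂

  Footprint : Set₁
  Footprint = S → Set

  δ : S → Footprint
  δ σ σ' = ∀ σ'' → (Defined (σ' * σ'') → Defined (σ * σ''))
                 × (Defined (σ * σ'') → Defined (σ' * σ''))

  _≐_ : Footprint → Footprint → Set
  l ≐ l' = ∀ x → (l x → l' x) × (l' x → l x)

  FootprintCancellative : Set
  FootprintCancellative =
    ∀ {σ₁ σ₂ σ₁' σ₂' a a'} → σ₁ * σ₂ ≡ just a → σ₁' * σ₂' ≡ just a' →
      δ a ≐ δ a' → δ σ₁ ≐ δ σ₁' → δ σ₂ ≐ δ σ₂'

  Precise : (S → Set) → Set
  Precise r = ∀ {σ σ₁ σ₁' σ₂ σ₂'} → r σ₁ → r σ₁' →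
    σ₁ * σ₂ ≡ just σ → σ₁' * σ₂' ≡ just σ → σ₁ ≡ σ₁'

Tid : Set
Tid = ℕ

data Com (Cmd : Set) : Set where
  prim   : Cmd → Com Cmd
  _⨟_    : Com Cmd → Com Cmd → Com Cmd
  _⊕_    : Com Cmd → Com Cmd → Com Cmd
  _⋆     : Com Cmd → Com Cmd

data Gen {Cmd : Set} : Com Cmd → List Cmd → Set where
  g-prim  : ∀ c → Gen (prim c) [ c ]
  g-seq   : ∀ {C₁ C₂ u v} → Gen C₁ u → Gen C₂ v → Gen (C₁ ⨟ C₂) (u ++ v)
  g-left  : ∀ {C₁ C₂ u} → Gen C₁ u → Gen (C₁ ⊕ C₂) u
  g-right : ∀ {C₁ C₂ u} → Gen C₂ u → Gen (C₁ ⊕ C₂) u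
  g-nil   : ∀ {C} → Gen (C ⋆) []
  g-more  : ∀ {C u v} → Gen C u → Gen (C ⋆) v → Gen (C ⋆) (u ++ v)

data Interleave {A : Set} : ∀ {k} → Vec (List A) k → List A → Set where
  i-done : ∀ {k} {ls : Vec (List A) k} → VAll.All (_≡ []) ls → Interleave ls []
  i-step : ∀ {k} {ls : Vec (List A) k} (i : Fin k) {x xs ys} →
           lookup ls i ≡ x ∷ xs → Interleave (ls [ i ]≔ xs) ys → Interleave ls (x ∷ ys)

data PT (S : Set) : Set₁ where
  top : PT S
  set : (S → Set) → PT S

record PrimCmds (SA : SepAlg) (Cmd : Set) : Set₁ where
  open SepAlg SA
  field
    f : Tid → Cmd → S → PT S
    footprintPreservation : ∀ {t c σ P σ'} → f t c σ ≡ set P → P σ' → δ σ' ≐ δ σ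
    strongLocality : ∀ {t c σ₁ σ₂ σ₁₂ P} → σ₁ * σ₂ ≡ just σ₁₂ → f t c σ₁ ≡ set P →
      ∃[ Q ] (f t c σ₁₂ ≡ set Q ×
              (∀ x → (Q x → ∃[ σ' ] (P σ' × σ' * σ₂ ≡ just x))
                   × (∃[ σ' ] (P σ' × σ' * σ₂ ≡ just x) → Q x)))

record Triple (SA : SepAlg) : Set₁ where
  open SepAlg SA
  field
    p : Tid → S → Set
    q : Tid → S → Set
    p-precise : ∀ t → Precise (p t)
    q-precise : ∀ t → Precise (q t)

module Semantics (SA : SepAlg) {Cmd : Set} (PC : PrimCmds SA Cmd) {Meth : Set} where
  open SepAlg SA
  open PrimCmds PC

  Library : Set
  Library = Meth → Com Cmd

  MethodSpec : Set₁
  MethodSpec = Meth → Maybe (Triple SA)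

  data Action : Set where
    call : Tid → Meth → Action
    ret  : Tid → Meth → Action
    act  : Tid → Cmd → Action

  -- annotated actions (calls/returns of unspecified methods stay unannotated)
  data AAction : Set where
    acall  : Tid → Meth → S → AAction
    aret   : Tid → Meth → S → AAction
    aact   : Tid → Cmd → AAction
    ucall  : Tid → Meth → AAction
    uret   : Tid → Meth → AAction

  data Invocations (L : Library) (t : Tid) : List Action → Set where
    inv-nil  : Invocations L t []
    inv-cons : ∀ m {cs rest} → Gen (L m) cs → Invocations L t rest →
               Invocations L t ((call t m ∷ map (act t) cs ++ [ ret t m ]) ++ rest)

  IsTrace : Library → List Action → Set
  IsTrace L tr = ∃[ k ] (k ≥ 1 × ∃[ ls ] (((i : Fin k) → Invocations L (toℕ i) (lookup ls i))
                   × ∃[ full ] (Interleave {k = k} ls full × ∃[ suf ] (tr ++ suf ≡ full))))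

  data Step (Γ : MethodSpec) : S → Action → S → AAction → Set₁ where
    s-act   : ∀ {t c σ P σ'} → f t c σ ≡ set P → P σ' → Step Γ σ (act t c) σ' (aact t c)
    s-call  : ∀ {t m σ σp σ'} (T : Triple SA) → Γ m ≡ just T → Triple.p T t σp →
              σ * σp ≡ just σ' → Step Γ σ (call t m) σ' (acall t m σp)
    s-ret   : ∀ {t m σ σq σ'} (T : Triple SA) → Γ m ≡ just T → Triple.q T t σq →
              σq * σ' ≡ just σ → Step Γ σ (ret t m) σ' (aret t m σq)
    s-ucall : ∀ {t m σ} → Γ m ≡ nothing → Step Γ σ (call t m) σ (ucall t m)
    s-uret  : ∀ {t m σ} → Γ m ≡ nothing → Step Γ σ (ret t m) σ (uret t m)

  data Faults (Γ : MethodSpec) : S → Action → Set₁ where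
    f-act : ∀ {t c σ} → f t c σ ≡ top → Faults Γ σ (act t c)
    f-ret : ∀ {t m σ} (T : Triple SA) → Γ m ≡ just T →
            ¬ (∃[ σq ] ∃[ σ' ] (Triple.q T t σq × σq * σ' ≡ just σ)) → Faults Γ σ (ret t m)

  data Eval (Γ : MethodSpec) : S → List Action → S → List AAction → Set₁ where
    e-nil  : ∀ {σ} → Eval Γ σ [] σ []
    e-cons : ∀ {σ a σ₁ â tr σ' λ'} → Step Γ σ a σ₁ â → Eval Γ σ₁ tr σ' λ' →
             Eval Γ σ (a ∷ tr) σ' (â ∷ λ')

  data EvalFaults (Γ : MethodSpec) : S → List Action → Set₁ where
    ef-here  : ∀ {σ a tr} → Faults Γ σ a → EvalFaults Γ σ (a ∷ tr)
    ef-there : ∀ {σ a σ₁ â tr} → Step Γ σ a σ₁ â → EvalFaults Γ σ₁ tr → EvalFaults Γ σ (a ∷ tr)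

  -- λ ∈ [[L : Γ']]σ : the semantics is not ⊤ and λ is among the resulting traces
  InSem : Library → MethodSpec → S → List AAction → Set₁
  InSem L Γ σ λ' = (∀ tr → IsTrace L tr → ¬ EvalFaults Γ σ tr)
                 × ∃[ tr ] (IsTrace L tr × ∃[ σ' ] Eval Γ σ tr σ' λ')

  history : List AAction → List AAction
  history [] = []
  history (aact t c ∷ λ') = history λ'
  history (a ∷ λ') = a ∷ history λ'

  -- abstract footprint semantics [[H]]♯ (relational; an output exists iff defined)
  data AStep : AAction → Footprint → Footprint → Set₁ where
    -- l ∘ δ(σ) = δ(σ₁ * σ₂) where l = δ(σ₁), δ(σ) = δ(σ₂)
    a-call : ∀ {t m σ l σ₁ σ₂ σ₁₂} → l ≐ δ σ₁ → δ σ ≐ δ σ₂ → σ₁ * σ₂ ≡ just σ₁₂ →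
             AStep (acall t m σ) l (δ σ₁₂)
    -- l \\ δ(σ) = δ(τ) where l = δ(σ₂), δ(σ) = δ(σ₁), σ₂ = σ₁ * τ
    a-ret  : ∀ {t m σ l σ₁ σ₂ τ} → l ≐ δ σ₂ → δ σ ≐ δ σ₁ → σ₁ * τ ≡ just σ₂ →
             AStep (aret t m σ) l (δ τ)
    a-ucall : ∀ {t m l} → AStep (ucall t m) l l
    a-uret  : ∀ {t m l} → AStep (uret t m) l l

  data ASem : List AAction → Footprint → Footprint → Set₁ where
    as-nil  : ∀ {l} → ASem [] l l
    as-cons : ∀ {ψ H l l₁ l'} → AStep ψ l l₁ → ASem H l₁ l' → ASem (ψ ∷ H) l l'

  BalancedFrom : List AAction → Footprint → Set₁
  BalancedFrom H l = ∃[ l' ] ASem H l l'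

-- Every step of the library-local semantics is mirrored by the footprint semantics:
-- primitive commands preserve the footprint of the state (Footprint Preservation) and
-- are invisible in the history, while annotated calls and returns compose with, resp.
-- split off, exactly the footprint of the transferred state. Hence along any evaluation
-- the abstract footprint stays equal to δ of the current concrete state and is never
-- undefined.
module Submission where

open import Defs
open import Data.List using (List)
open import Data.Maybe using (Maybe)
open import Data.Product using (∃-syntax; _×_; _,_; proj₁; proj₂; swap)
open import Function using (id)

module FootprintEquality (SA : SepAlg) where
  open SepAlg SA

  ≐-refl : ∀ {l} → l ≐ l
  ≐-refl x = id , id

  ≐-sym : ∀ {l l'} → l ≐ l' → l' ≐ l
  ≐-sym p x = swap (p x)

  ≐-trans : ∀ {l l' l''} → l ≐ l' → l' ≐ l'' → l ≐ l''
  ≐-trans p q x = (λ z → proj₁ (q x) (proj₁ (p x) z)) , (λ z → proj₂ (p x) (proj₂ (q x) z))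

module FootprintTracking (SA : SepAlg) {Cmd : Set} (PC : PrimCmds SA Cmd) {Meth : Set} where
  open SepAlg SA
  open PrimCmds PC
  open Semantics SA PC {Meth}
  open FootprintEquality SA

  history-tracks-δ : ∀ {Γ σ tr σ' λ' l} → Eval Γ σ tr σ' λ' → l ≐ δ σ →
    ∃[ l' ] (ASem (history λ') l l' × l' ≐ δ σ')
  history-tracks-δ e-nil l≐δσ = _ , as-nil , l≐δσ
  history-tracks-δ (e-cons (s-act fσ≡P Pσ₁) ev) l≐δσ =
    history-tracks-δ ev (≐-trans l≐δσ (≐-sym (footprintPreservation fσ≡P Pσ₁)))
  history-tracks-δ (e-cons (s-call _ _ _ σ*σp≡σ₁) ev) l≐δσ
    with history-tracks-δ ev ≐-refl
  ... | l' , run , l'≐δσ' = l' , as-cons (a-call l≐δσ ≐-refl σ*σp≡σ₁) run , l'≐δσ'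
  history-tracks-δ (e-cons (s-ret _ _ _ σq*σ₁≡σ) ev) l≐δσ
    with history-tracks-δ ev ≐-refl
  ... | l' , run , l'≐δσ' = l' , as-cons (a-ret l≐δσ ≐-refl σq*σ₁≡σ) run , l'≐δσ'
  history-tracks-δ (e-cons (s-ucall _) ev) l≐δσ
    with history-tracks-δ ev l≐δσ
  ... | l' , run , l'≐δσ' = l' , as-cons a-ucall run , l'≐δσ'
  history-tracks-δ (e-cons (s-uret _) ev) l≐δσ
    with history-tracks-δ ev l≐δσ
  ... | l' , run , l'≐δσ' = l' , as-cons a-uret run , l'≐δσ'

proposition5p4 : (SA : SepAlg) → SepAlg.FootprintCancellative SA →
    {Cmd : Set} (PC : PrimCmds SA Cmd) {Meth : Set} →
    (L : Meth → Com Cmd) (Γ' : Meth → Maybe (Triple SA)) (σ : SepAlg.S SA)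
    (λ' : List (Semantics.AAction SA PC {Meth})) →
    Semantics.InSem SA PC L Γ' σ λ' →
    Semantics.BalancedFrom SA PC (Semantics.history SA PC λ') (SepAlg.δ SA σ)
proposition5p4 SA _ PC {Meth} L Γ' σ λ' (_ , _ , _ , _ , ev)
  with FootprintTracking.history-tracks-δ SA PC {Meth} ev (FootprintEquality.≐-refl SA)
... | l' , run , _ = l' , run
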